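{- Let $\mathbf{t}$ be the Tribonacci word. If $k\ge 1$ and $\frac{T_k+T_{k-2}-3}{2}<n\le \frac{T_{k+1}+T_{k-1}-3}{2}$, then $\operatorname{nsc}_{\mathbf{t}}(n)=T_k$.
   Context: The Tribonacci word is $\mathbf{t}=\sigma^{\omega}(0)=0102010010201\cdots$, the fixed point of the morphism $\sigma(0)=01$, $\sigma(1)=02$, $\sigma(2)=0$. The Tribonacci numbers are $T_{ -1}=1$, $T_0=1$, $T_1=2$, $T_2=4$, $T_k=T_{k-1}+T_{k-2}+T_{k-3}$ for $k\ge3$. For an infinite word $\mathbf{x}=x_0x_1x_2\cdots$ (indexed from $0$) and $n\ge1$, $\operatorname{nsc}_{\mathbf{x}}(n)=\max\{m\in\mathbb{N}: x_i\cdots x_{i+n-1}\neq x_j\cdots x_{j+n-1}\text{ for all } 0\le i<j\le m-1\}$. -}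

module Defs where

open import Data.Nat using (ℕ; zero; suc; _+_; _*_; _<_; _≤_)
open import Data.Fin using (Fin; zero; suc)
open import Data.List using (List; []; _∷_; _++_; concatMap)
open import Data.Product using (_×_)
open import Relation.Binary.PropositionalEquality using (_≡_)
open import Relation.Nullary using (¬_)

-- Tribonacci numbers, shifted: Trib j = T_{j-1}.
-- Trib 0 = T_{-1} = 1, Trib 1 = T_0 = 1, Trib 2 = T_1 = 2, Trib 3 = T_2 = 4.
Trib : ℕ → ℕ
Trib 0 = 1
Trib 1 = 1
Trib 2 = 2
Trib 3 = 4
Trib (suc (suc (suc (suc j)))) =
  Trib (suc (suc (suc j))) + Trib (suc (suc j)) + Trib (suc j)

T : ℕ → ℕ
T k = Trib (suc k)

σ : Fin 3 → List (Fin 3)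
σ zero = zero ∷ suc zero ∷ []
σ (suc zero) = zero ∷ suc (suc zero) ∷ []
σ (suc (suc zero)) = zero ∷ []

σ* : List (Fin 3) → List (Fin 3)
σ* = concatMap σ

σ^ : ℕ → List (Fin 3) → List (Fin 3)
σ^ zero w = w
σ^ (suc k) w = σ* (σ^ k w)

-- i-th letter of a list, defaulting to 0 out of range (never used out of range below)
at : List (Fin 3) → ℕ → Fin 3
at [] _ = zero
at (a ∷ _) zero = a
at (_ ∷ w) (suc i) = at w i

-- The Tribonacci word t = σ^ω(0): since σ^m(0) is a prefix of σ^(m+1)(0) and
-- |σ^m(0)| = T_{m-1} ≥ m+1, letter i of t is letter i of σ^(i+1)(0).
t : ℕ → Fin 3
t i = at (σ^ (suc i) (zero ∷ [])) i

SameFactor : (ℕ → Fin 3) → ℕ → ℕ → ℕ → Set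
SameFactor x n i j = ∀ l → l < n → x (i + l) ≡ x (j + l)

FirstDistinct : (ℕ → Fin 3) → ℕ → ℕ → Set
FirstDistinct x n m = ∀ i j → i < j → suc j ≤ m → ¬ SameFactor x n i j

IsNsc : (ℕ → Fin 3) → ℕ → ℕ → Set
IsNsc x n m = FirstDistinct x n m × (∀ m' → FirstDistinct x n m' → m' ≤ m)

module Submission where

-- Proof idea.  Write c m = |σ(t₀⋯t_{m-1})|; since t = σ(t), the block σ(t_m) of t
-- starts at position c m.  Two facts about this desubstitution drive everything:
--
--  * Divergences lift and descend.  If the factors of t at i and j first differ at
--    offset q, then those at c i and c j first differ at offset |σ(t_i⋯t_{i+q-1})| + 1,
--    and every divergence between two block starts arises in this way.
--  * Right special factors are reversed prefixes.  The common part of two factors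
--    before they diverge is the reversal of a prefix of t (by induction on i + j,
--    using reverse(σ(y)0) = σ(reverse y)0); in particular its image has the same
--    length as the image of the prefix of the same length.
--
-- With S k = T₀ + ⋯ + T_{k-1} these give: the prefix of length S k reappears at
-- position T k (so nsc(n) ≤ T k for n ≤ S k), and any two positions below T k diverge
-- within the first S (k-1) + 1 letters (so nsc(n) ≥ T k for n > S (k-1)).  The
-- window of the theorem is exactly S (k-1) < n ≤ S k.

open import Defs
open import Data.Nat
  using (ℕ; zero; suc; _+_; _*_; _∸_; _<_; _≤_; _≤′_; ≤′-refl; ≤′-step; z≤n; s≤s; _<?_)
open import Data.Nat.Properties
open import Data.Nat.Tactic.RingSolver using (solve-∀)
open import Data.Fin using (Fin; zero; suc) renaming (_≟_ to _≟ᶠ_)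
open import Data.List using (List; []; _∷_; _++_; [_]; length; reverse)
open import Data.List.Properties
  using (++-assoc; ++-identityʳ; ++-cancelˡ; length-++; length-reverse; reverse-++;
         unfold-reverse; concatMap-++; ∷-injectiveˡ; ∷-injectiveʳ)
open import Data.Product using (∃-syntax; _×_; _,_; proj₁; proj₂)
open import Data.Sum using (_⊎_; inj₁; inj₂)
open import Data.Empty using (⊥-elim)
open import Relation.Nullary using (yes; no)
open import Relation.Binary.Definitions using (tri<; tri≈; tri>)
open import Relation.Binary.PropositionalEquality hiding ([_])

Letter : Set
Letter = Fin 3

P : ℕ → List Letter
P k = σ^ k (zero ∷ [])

P-extends : ∀ k → ∃[ x ] P (suc k) ≡ P k ++ x
P-extends zero = suc zero ∷ [] , refl
P-extends (suc k) with P-extends k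
... | x , eq = σ* x , trans (cong σ* eq) (concatMap-++ σ (P k) x)

P-prefix : ∀ {a b} → a ≤′ b → ∃[ x ] P b ≡ P a ++ x
P-prefix {a} ≤′-refl = [] , sym (++-identityʳ (P a))
P-prefix {a} (≤′-step {b} a≤′b) with P-prefix a≤′b | P-extends b
... | x , eq₁ | y , eq₂ = x ++ y , (begin
  P (suc b)        ≡⟨ eq₂ ⟩
  P b ++ y         ≡⟨ cong (_++ y) eq₁ ⟩
  (P a ++ x) ++ y  ≡⟨ ++-assoc (P a) x y ⟩
  P a ++ (x ++ y)  ∎)
  where open ≡-Reasoning

P-rec : ∀ k → P (3 + k) ≡ P (2 + k) ++ (P (1 + k) ++ P k)
P-rec zero = refl
P-rec (suc k) = begin
  σ* (P (3 + k))                              ≡⟨ cong σ* (P-rec k) ⟩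
  σ* (P (2 + k) ++ (P (1 + k) ++ P k))        ≡⟨ concatMap-++ σ (P (2 + k)) _ ⟩
  P (3 + k) ++ σ* (P (1 + k) ++ P k)          ≡⟨ cong (P (3 + k) ++_) (concatMap-++ σ (P (1 + k)) (P k)) ⟩
  P (3 + k) ++ (P (2 + k) ++ P (1 + k))       ∎
  where open ≡-Reasoning

length-P : ∀ k → length (P k) ≡ T k
length-P zero = refl
length-P (suc zero) = refl
length-P (suc (suc zero)) = refl
length-P (suc (suc (suc k))) = begin
  length (P (3 + k))                                     ≡⟨ cong length (P-rec k) ⟩
  length (P (2 + k) ++ (P (1 + k) ++ P k))               ≡⟨ length-++ (P (2 + k)) ⟩
  length (P (2 + k)) + length (P (1 + k) ++ P k)         ≡⟨ cong (length (P (2 + k)) +_) (length-++ (P (1 + k))) ⟩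
  length (P (2 + k)) + (length (P (1 + k)) + length (P k)) ≡⟨ sym (+-assoc (length (P (2 + k))) _ _) ⟩
  length (P (2 + k)) + length (P (1 + k)) + length (P k) ≡⟨ cong₂ _+_ (cong₂ _+_ (length-P (suc (suc k))) (length-P (suc k)))
                                                                      (length-P k) ⟩
  T (3 + k)                                              ∎
  where open ≡-Reasoning

-- T n > n, so σⁿ(0) is long enough to contain position n.
T-grows : ∀ n → n < T n
T-grows zero = s≤s z≤n
T-grows (suc zero) = s≤s (s≤s z≤n)
T-grows (suc (suc zero)) = s≤s (s≤s (s≤s z≤n))
T-grows (suc (suc (suc n))) = begin-strict
  3 + n                      ≤⟨ T-grows (suc (suc n)) ⟩
  T (2 + n)                  <⟨ m<m+n (T (2 + n)) (≤-<-trans z≤n (T-grows (suc n))) ⟩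
  T (2 + n) + T (1 + n)      ≤⟨ m≤m+n _ (T n) ⟩
  T (3 + n)                  ∎
  where open ≤-Reasoning

at-++ˡ : ∀ (u v : List Letter) {i} → i < length u → at (u ++ v) i ≡ at u i
at-++ˡ (a ∷ u) v {zero} _ = refl
at-++ˡ (a ∷ u) v {suc i} (s≤s i<) = at-++ˡ u v i<

OccursAt : List Letter → ℕ → Set
OccursAt u i = ∀ q → q < length u → t (i + q) ≡ at u q

occurs-++ˡ : ∀ u v {i} → OccursAt (u ++ v) i → OccursAt u i
occurs-++ˡ u v occ q q< = trans (occ q (≤-trans q< u≤uv)) (at-++ˡ u v q<)
  where
  u≤uv : length u ≤ length (u ++ v)
  u≤uv = subst (length u ≤_) (sym (length-++ u)) (m≤m+n (length u) (length v))

P-stable : ∀ {a b i} → a ≤ b → i < length (P a) → at (P b) i ≡ at (P a) i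
P-stable {a} {i = i} a≤b i<a with P-prefix (≤⇒≤′ a≤b)
... | x , eq = trans (cong (λ w → at w i) eq) (at-++ˡ (P a) x i<a)

P-occurs : ∀ k → OccursAt (P k) 0
P-occurs k i i< with ≤-total (suc i) k
... | inj₁ i<k = sym (P-stable i<k i<P)
  where
  i<P : i < length (P (suc i))
  i<P = subst (i <_) (sym (length-P (suc i))) (<-trans (n<1+n i) (T-grows (suc i)))
... | inj₂ k≤i = P-stable k≤i i<

factor : ℕ → ℕ → List Letter
factor i zero = []
factor i (suc n) = t i ∷ factor (suc i) n

factor-++ : ∀ i m n → factor i (m + n) ≡ factor i m ++ factor (i + m) n
factor-++ i zero n = cong (λ x → factor x n) (sym (+-identityʳ i))
factor-++ i (suc m) n = cong (t i ∷_) (trans (factor-++ (suc i) m n)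
  (cong (λ x → factor (suc i) m ++ factor x n) (sym (+-suc i m))))

factor-snoc : ∀ i n → factor i (suc n) ≡ factor i n ++ [ t (i + n) ]
factor-snoc i n = trans (cong (factor i) (+-comm 1 n)) (factor-++ i n 1)

factor-at : ∀ i {n l} → l < n → at (factor i n) l ≡ t (i + l)
factor-at i {suc n} {zero} _ = cong t (sym (+-identityʳ i))
factor-at i {suc n} {suc l} (s≤s l<n) = trans (factor-at (suc i) l<n) (cong t (sym (+-suc i l)))

factor-occurrence : ∀ u {i} → OccursAt u i → factor i (length u) ≡ u
factor-occurrence [] occ = refl
factor-occurrence (a ∷ u) {i} occ = cong₂ _∷_
  (trans (cong t (sym (+-identityʳ i))) (occ 0 (s≤s z≤n)))
  (factor-occurrence u (λ q q< → trans (cong t (sym (+-suc i q))) (occ (suc q) (s≤s q<))))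

prefix-is-P : ∀ k → factor 0 (T k) ≡ P k
prefix-is-P k = subst (λ n → factor 0 n ≡ P k) (length-P k) (factor-occurrence (P k) (P-occurs k))

factors-agree : ∀ {i j m} → factor i m ≡ factor j m → SameFactor t m i j
factors-agree {i} {j} eq l l<m =
  trans (sym (factor-at i l<m)) (trans (cong (λ w → at w l) eq) (factor-at j l<m))

record Diverge (i j l : ℕ) : Set where
  constructor diverge
  field
    agree  : factor i l ≡ factor j l
    differ : t (i + l) ≢ t (j + l)
open Diverge

diverge-distinct : ∀ {i j l} → Diverge i j l → i ≢ j
diverge-distinct d refl = differ d refl

diverge-at-0 : ∀ {i j} → t i ≢ t j → Diverge i j 0
diverge-at-0 {i} {j} ti≢tj = diverge refl
  (λ eq → ti≢tj (trans (cong t (sym (+-identityʳ i))) (trans eq (cong t (+-identityʳ j)))))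

diverge-head : ∀ {i j l} → Diverge i j (suc l) → t i ≡ t j
diverge-head d = ∷-injectiveˡ (agree d)

diverge-pred : ∀ {i j l} → t i ≡ t j → Diverge (suc i) (suc j) l → Diverge i j (suc l)
diverge-pred {i} {j} {l} ti≡tj d = diverge (cong₂ _∷_ ti≡tj (agree d))
  (λ eq → differ d (trans (cong t (sym (+-suc i l))) (trans eq (cong t (+-suc j l)))))

diverge-suc : ∀ {i j l} → Diverge i j (suc l) → Diverge (suc i) (suc j) l
diverge-suc {i} {j} {l} d = diverge (∷-injectiveʳ (agree d))
  (λ eq → differ d (trans (cong t (+-suc i l)) (trans eq (cong t (sym (+-suc j l))))))

diverge-unique : ∀ {i j l l′} → Diverge i j l → Diverge i j l′ → l ≡ l′
diverge-unique {l = l} {l′} d d′ with <-cmp l l′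
... | tri< l<l′ _ _ = ⊥-elim (differ d (factors-agree (agree d′) l l<l′))
... | tri≈ _ l≡l′ _ = l≡l′
... | tri> _ _ l′<l = ⊥-elim (differ d′ (factors-agree (agree d) l′ l′<l))

agree-or-diverge : ∀ i j n → factor i (suc n) ≡ factor j (suc n) ⊎ ∃[ q ] q ≤ n × Diverge i j q
agree-or-diverge i j n with t i ≟ᶠ t j
... | no ti≢tj = inj₂ (0 , z≤n , diverge-at-0 ti≢tj)
agree-or-diverge i j zero | yes ti≡tj = inj₁ (cong (_∷ []) ti≡tj)
agree-or-diverge i j (suc n) | yes ti≡tj with agree-or-diverge (suc i) (suc j) n
... | inj₁ same = inj₁ (cong₂ _∷_ ti≡tj same)
... | inj₂ (q , q≤n , d) = inj₂ (suc q , s≤s q≤n , diverge-pred ti≡tj d)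

W : ℕ → ℕ → ℕ
W i n = length (σ* (factor i n))

-- c m = |σ(t₀ ⋯ t_{m-1})|, where the block σ(t_m) starts inside t = σ(t).
c : ℕ → ℕ
c m = W 0 m

W-agree : ∀ {i j} n → factor i n ≡ factor j n → W i n ≡ W j n
W-agree n eq = cong (λ w → length (σ* w)) eq

W-++ : ∀ i m n → W i (m + n) ≡ W i m + W (i + m) n
W-++ i m n = trans (cong (λ w → length (σ* w)) (factor-++ i m n))
  (trans (cong length (concatMap-++ σ (factor i m) _)) (length-++ (σ* (factor i m))))

σ-nonempty : ∀ a → 0 < length (σ a)
σ-nonempty zero = s≤s z≤n
σ-nonempty (suc zero) = s≤s z≤n
σ-nonempty (suc (suc zero)) = s≤s z≤n

σ-short : ∀ a → length (σ a) ≤ 2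
σ-short zero = ≤-refl
σ-short (suc zero) = ≤-refl
σ-short (suc (suc zero)) = s≤s z≤n

σ-head : ∀ a → at (σ a) 0 ≡ zero
σ-head zero = refl
σ-head (suc zero) = refl
σ-head (suc (suc zero)) = refl

σ-second-nonzero : ∀ a → 1 < length (σ a) → at (σ a) 1 ≢ zero
σ-second-nonzero zero _ ()
σ-second-nonzero (suc zero) _ ()
σ-second-nonzero (suc (suc zero)) (s≤s ())

-- σ is non-erasing, so images are at least as long as their preimages.
W-lower : ∀ i n → n ≤ W i n
W-lower i zero = z≤n
W-lower i (suc n) = ≤-trans (+-mono-≤ (σ-nonempty (t i)) (W-lower (suc i) n))
  (≤-reflexive (sym (length-++ (σ (t i)))))

W-mono : ∀ i {m n} → m ≤ n → W i m ≤ W i n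
W-mono i {m} {n} m≤n = subst (λ x → W i m ≤ W i x) (m+[n∸m]≡n m≤n)
  (subst (W i m ≤_) (sym (W-++ i m (n ∸ m))) (m≤m+n (W i m) _))

c-suc : ∀ m → c (suc m) ≡ c m + length (σ (t m))
c-suc m = trans (cong c (+-comm 1 m)) (trans (W-++ 0 m 1) (cong (c m +_) (cong length (++-identityʳ (σ (t m))))))

c-reflects-< : ∀ {a b} → c a < c b → a < b
c-reflects-< ca<cb = ≰⇒> (λ b≤a → <⇒≱ ca<cb (W-mono 0 b≤a))

-- Since σ(t₀) = σ(0) = 01 has length 2, c strictly expands every positive argument.
c-expands : ∀ a → suc a < c (suc a)
c-expands a = s≤s (s≤s (W-lower 1 a))

c-sum-expands : ∀ {a b} → a ≢ b → a + b < c a + c b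
c-sum-expands {zero} {zero} a≢b = ⊥-elim (a≢b refl)
c-sum-expands {zero} {suc b} _ = c-expands b
c-sum-expands {suc a} {b} _ = +-mono-<-≤ (c-expands a) (W-lower 0 b)

-- t = σ(t): the prefix of length c m is the image of the prefix of length m.
image-prefix : ∀ m → factor 0 (c m) ≡ σ* (factor 0 m)
image-prefix m =
  factor-occurrence (σ* (factor 0 m)) (occurs-++ˡ (σ* (factor 0 m)) (σ* rest) {0} image-occurs)
  where
  rest : List Letter
  rest = factor m (T m ∸ m)
  P-split : P m ≡ factor 0 m ++ rest
  P-split = begin
    P m                          ≡⟨ sym (prefix-is-P m) ⟩
    factor 0 (T m)               ≡⟨ cong (factor 0) (sym (m+[n∸m]≡n (<⇒≤ (T-grows m)))) ⟩
    factor 0 (m + (T m ∸ m))     ≡⟨ factor-++ 0 m _ ⟩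
    factor 0 m ++ rest           ∎
    where open ≡-Reasoning
  image-occurs : OccursAt (σ* (factor 0 m) ++ σ* rest) 0
  image-occurs = subst (λ u → OccursAt u 0)
    (trans (cong σ* P-split) (concatMap-++ σ (factor 0 m) rest)) (P-occurs (suc m))

image-factor : ∀ m l → factor (c m) (W m l) ≡ σ* (factor m l)
image-factor m l = ++-cancelˡ (σ* (factor 0 m)) _ _ (begin
  σ* (factor 0 m) ++ factor (c m) (W m l)   ≡⟨ cong (_++ factor (c m) (W m l)) (sym (image-prefix m)) ⟩
  factor 0 (c m) ++ factor (c m) (W m l)    ≡⟨ sym (factor-++ 0 (c m) (W m l)) ⟩
  factor 0 (c m + W m l)                    ≡⟨ cong (factor 0) (sym (W-++ 0 m l)) ⟩
  factor 0 (c (m + l))                      ≡⟨ image-prefix (m + l) ⟩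
  σ* (factor 0 (m + l))                     ≡⟨ cong σ* (factor-++ 0 m l) ⟩
  σ* (factor 0 m ++ factor m l)             ≡⟨ concatMap-++ σ (factor 0 m) (factor m l) ⟩
  σ* (factor 0 m) ++ σ* (factor m l)        ∎)
  where open ≡-Reasoning

block-letter : ∀ m {a r} → t m ≡ a → r < length (σ a) → t (c m + r) ≡ at (σ a) r
block-letter m {r = r} refl r<σ = begin
  t (c m + r)                       ≡⟨ sym (factor-at (c m) r<W) ⟩
  at (factor (c m) (W m 1)) r       ≡⟨ cong (λ w → at w r) (image-factor m 1) ⟩
  at (σ (t m) ++ []) r              ≡⟨ cong (λ w → at w r) (++-identityʳ (σ (t m))) ⟩
  at (σ (t m)) r                    ∎
  where
  open ≡-Reasoning
  r<W : r < W m 1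
  r<W = subst (λ w → r < length w) (sym (++-identityʳ (σ (t m)))) r<σ

cut-letter : ∀ m → t (c m) ≡ zero
cut-letter m = trans (cong t (sym (+-identityʳ (c m))))
  (trans (block-letter m refl (σ-nonempty (t m))) (σ-head (t m)))

-- The letter after the start of block m is 1, 2, 0 according as t_m is 0, 1, 2;
-- in particular it determines t_m.
rot : Letter → Letter
rot zero = suc zero
rot (suc zero) = suc (suc zero)
rot (suc (suc zero)) = zero

rot⁻¹ : Letter → Letter
rot⁻¹ zero = suc (suc zero)
rot⁻¹ (suc zero) = zero
rot⁻¹ (suc (suc zero)) = suc zero

rot-injective : ∀ {a b} → rot a ≡ rot b → a ≡ b
rot-injective {a} {b} eq = trans (inverse a) (trans (cong rot⁻¹ eq) (sym (inverse b)))
  where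
  inverse : ∀ x → x ≡ rot⁻¹ (rot x)
  inverse zero = refl
  inverse (suc zero) = refl
  inverse (suc (suc zero)) = refl

letter-after-cut : ∀ m → t (suc (c m)) ≡ rot (t m)
letter-after-cut m with t m in tm
... | zero = trans (cong t (+-comm 1 (c m))) (block-letter m tm ≤-refl)
... | suc zero = trans (cong t (+-comm 1 (c m))) (block-letter m tm ≤-refl)
... | suc (suc zero) = trans (cong t next-block) (cut-letter (suc m))
  where
  next-block : suc (c m) ≡ c (suc m)
  next-block = sym (trans (c-suc m) (trans (cong (λ a → c m + length (σ a)) tm) (+-comm (c m) 1)))

block-decomposition : ∀ p → ∃[ q ] ∃[ r ] r < length (σ (t q)) × p ≡ c q + r
block-decomposition zero = 0 , 0 , σ-nonempty (t 0) , refl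
block-decomposition (suc p) with block-decomposition p
... | q , r , r< , p≡ with suc r <? length (σ (t q))
...   | yes r+1< = q , suc r , r+1< , trans (cong suc p≡) (sym (+-suc (c q) r))
...   | no r+1≮ = suc q , 0 , σ-nonempty (t (suc q)) , (begin
  suc p                      ≡⟨ cong suc p≡ ⟩
  suc (c q + r)              ≡⟨ sym (+-suc (c q) r) ⟩
  c q + suc r                ≡⟨ cong (c q +_) (≤-antisym r< (≮⇒≥ r+1≮)) ⟩
  c q + length (σ (t q))     ≡⟨ sym (c-suc q) ⟩
  c (suc q)                  ≡⟨ sym (+-identityʳ _) ⟩
  c (suc q) + 0              ∎)
  where open ≡-Reasoning

-- Since blocks have length at most 2, a position is a block start or the second letter
-- of a block, which is never 0.
data Position : ℕ → Set where
  cut   : ∀ q → Position (c q)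
  inner : ∀ q → t (suc (c q)) ≢ zero → Position (suc (c q))

position : ∀ p → Position p
position p with block-decomposition p
... | q , zero , _ , refl = subst Position (sym (+-identityʳ (c q))) (cut q)
... | q , suc zero , 1<σ , refl = subst Position (+-comm 1 (c q)) (inner q second≢0)
  where
  second≢0 : t (suc (c q)) ≢ zero
  second≢0 eq = σ-second-nonzero (t q) 1<σ
    (trans (sym (block-letter q refl 1<σ)) (trans (cong t (+-comm (c q) 1)) eq))
... | q , suc (suc r) , r< , _ = ⊥-elim (<⇒≱ r< (≤-trans (σ-short (t q)) (s≤s (s≤s z≤n))))

data Aligned : ℕ → ℕ → Set where
  at-cuts    : ∀ i j → Aligned (c i) (c j)
  after-cuts : ∀ i j → Aligned (suc (c i)) (suc (c j))

align : ∀ {i j} → t i ≡ t j → Aligned i j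
align {i} {j} ti≡tj with position i | position j
... | cut i′ | cut j′ = at-cuts i′ j′
... | inner i′ _ | inner j′ _ = after-cuts i′ j′
... | cut i′ | inner _ tj≢0 = ⊥-elim (tj≢0 (trans (sym ti≡tj) (cut-letter i′)))
... | inner _ ti≢0 | cut j′ = ⊥-elim (ti≢0 (trans ti≡tj (cut-letter j′)))

-- Each σ(a) is a palindrome once the 0 starting the next block is appended.
σ-0-palindromic : ∀ a → zero ∷ reverse (σ a) ≡ σ a ++ [ zero ]
σ-0-palindromic zero = refl
σ-0-palindromic (suc zero) = refl
σ-0-palindromic (suc (suc zero)) = refl

image-reverse : ∀ y → reverse (σ* y ++ [ zero ]) ≡ σ* (reverse y) ++ [ zero ]
image-reverse [] = refl
image-reverse (a ∷ y) = begin
  reverse ((σ a ++ σ* y) ++ [ zero ])            ≡⟨ cong reverse (++-assoc (σ a) (σ* y) [ zero ]) ⟩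
  reverse (σ a ++ (σ* y ++ [ zero ]))            ≡⟨ reverse-++ (σ a) _ ⟩
  reverse (σ* y ++ [ zero ]) ++ reverse (σ a)    ≡⟨ cong (_++ reverse (σ a)) (image-reverse y) ⟩
  (σ* (reverse y) ++ [ zero ]) ++ reverse (σ a)  ≡⟨ ++-assoc (σ* (reverse y)) [ zero ] _ ⟩
  σ* (reverse y) ++ (zero ∷ reverse (σ a))       ≡⟨ cong (σ* (reverse y) ++_) (σ-0-palindromic a) ⟩
  σ* (reverse y) ++ (σ a ++ [ zero ])            ≡⟨ sym (++-assoc (σ* (reverse y)) (σ a) _) ⟩
  (σ* (reverse y) ++ σ a) ++ [ zero ]            ≡⟨ cong (λ w → (σ* (reverse y) ++ w) ++ [ zero ]) (sym (++-identityʳ (σ a))) ⟩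
  (σ* (reverse y) ++ σ* [ a ]) ++ [ zero ]       ≡⟨ cong (_++ [ zero ]) (sym (concatMap-++ σ (reverse y) [ a ])) ⟩
  σ* (reverse y ++ [ a ]) ++ [ zero ]            ≡⟨ cong (λ w → σ* w ++ [ zero ]) (sym (unfold-reverse a y)) ⟩
  σ* (reverse (a ∷ y)) ++ [ zero ]               ∎
  where open ≡-Reasoning

image-length-reverse : ∀ y → length (σ* (reverse y)) ≡ length (σ* y)
image-length-reverse y = +-cancelʳ-≡ 1 _ _ (begin
  length (σ* (reverse y)) + 1            ≡⟨ sym (length-++ (σ* (reverse y))) ⟩
  length (σ* (reverse y) ++ [ zero ])    ≡⟨ cong length (sym (image-reverse y)) ⟩
  length (reverse (σ* y ++ [ zero ]))    ≡⟨ length-reverse (σ* y ++ [ zero ]) ⟩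
  length (σ* y ++ [ zero ])              ≡⟨ length-++ (σ* y) ⟩
  length (σ* y) + 1                      ∎)
  where open ≡-Reasoning

W-reversed-prefix : ∀ {i q} → factor i q ≡ reverse (factor 0 q) → W i q ≡ W 0 q
W-reversed-prefix {q = q} eq = trans (cong (λ w → length (σ* w)) eq) (image-length-reverse (factor 0 q))

reverse-prefix-suc : ∀ n → reverse (factor 0 (suc n)) ≡ t n ∷ reverse (factor 0 n)
reverse-prefix-suc n = trans (cong reverse (factor-snoc 0 n)) (reverse-++ (factor 0 n) [ t n ])

image-factor-0 : ∀ m q → factor (c m) (suc (W m q)) ≡ σ* (factor m q) ++ [ zero ]
image-factor-0 m q = trans (factor-snoc (c m) (W m q)) (cong₂ _++_ (image-factor m q)
  (cong [_] (trans (cong t (sym (W-++ 0 m q))) (cut-letter (m + q)))))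

image-agree : ∀ {i j} n → factor i n ≡ factor j n → factor (c i) (suc (W i n)) ≡ factor (c j) (suc (W i n))
image-agree {i} {j} n eq = begin
  factor (c i) (suc (W i n))      ≡⟨ image-factor-0 i n ⟩
  σ* (factor i n) ++ [ zero ]     ≡⟨ cong (λ w → σ* w ++ [ zero ]) eq ⟩
  σ* (factor j n) ++ [ zero ]     ≡⟨ sym (image-factor-0 j n) ⟩
  factor (c j) (suc (W j n))      ≡⟨ cong (λ x → factor (c j) (suc x)) (W-agree n (sym eq)) ⟩
  factor (c j) (suc (W i n))      ∎
  where open ≡-Reasoning

-- Divergences lift along σ: after the common image and the following 0, the letters
-- rot(t_{i+q}) ≠ rot(t_{j+q}) differ.
diverge-image : ∀ {i j q} → Diverge i j q → Diverge (c i) (c j) (suc (W i q))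
diverge-image {i} {j} {q} d = diverge (image-agree q (agree d)) images-differ
  where
  after : ∀ m → W m q ≡ W i q → c m + suc (W i q) ≡ suc (c (m + q))
  after m W≡ = trans (+-suc (c m) (W i q)) (cong suc (trans (cong (c m +_) (sym W≡)) (sym (W-++ 0 m q))))
  images-differ : t (c i + suc (W i q)) ≢ t (c j + suc (W i q))
  images-differ eq = differ d (rot-injective (begin
    rot (t (i + q))                ≡⟨ sym (letter-after-cut (i + q)) ⟩
    t (suc (c (i + q)))            ≡⟨ cong t (sym (after i refl)) ⟩
    t (c i + suc (W i q))          ≡⟨ eq ⟩
    t (c j + suc (W i q))          ≡⟨ cong t (after j (W-agree q (sym (agree d)))) ⟩
    t (suc (c (j + q)))            ≡⟨ letter-after-cut (j + q) ⟩
    rot (t (j + q))                ∎))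
    where open ≡-Reasoning

diverge-preimage : ∀ {i j L} → Diverge (c i) (c j) L → ∃[ q ] Diverge i j q × L ≡ suc (W i q)
diverge-preimage {i} {j} {L} D with agree-or-diverge i j L
... | inj₁ same = ⊥-elim (differ D (factors-agree (image-agree (suc L) same) L L<image))
  where
  L<image : L < suc (W i (suc L))
  L<image = s≤s (≤-trans (n≤1+n L) (W-lower i (suc L)))
... | inj₂ (q , _ , d) = q , d , diverge-unique D (diverge-image d)

-- Passing from two positions with equal letters to the blocks containing them
-- decreases i + j (block starts must differ, so c strictly expands their sum).
cuts-smaller : ∀ i j {N} → i ≢ j → c i + c j < suc N → i + j < N
cuts-smaller i j i≢j lt = <-≤-trans (c-sum-expands i≢j) (≤-pred lt)

after-cuts-smaller : ∀ i j {N} → suc (c i) + suc (c j) < suc N → i + j < N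
after-cuts-smaller i j lt = <-≤-trans
  (s≤s (+-mono-≤ (W-lower 0 i) (W-lower 0 j)))
  (≤-trans (+-monoʳ-≤ (suc (c i)) (n≤1+n (c j))) (≤-pred lt))

-- By
-- induction on (a bound N for) i + j, alternating between arbitrary positions and
-- block starts.
rightSpecial-bounded : ∀ N {i j l} → i + j < N → Diverge i j l → factor i l ≡ reverse (factor 0 l)
rightSpecial-at-cuts : ∀ N {i j L} → i + j < N → Diverge (c i) (c j) L → factor (c i) L ≡ reverse (factor 0 L)

rightSpecial-bounded N {l = zero} _ _ = refl
rightSpecial-bounded (suc N) {i} {j} {suc l} lt d with align {i} {j} (diverge-head d)
... | at-cuts i′ j′ =
  rightSpecial-at-cuts N {i′} {j′} (cuts-smaller i′ j′ blocks-differ lt) d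
  where
  blocks-differ : i′ ≢ j′
  blocks-differ i′≡j′ = diverge-distinct d (cong c i′≡j′)
... | after-cuts i′ j′ = ∷-injectiveʳ (trans
  (rightSpecial-at-cuts N {i′} {j′} (after-cuts-smaller i′ j′ lt) (diverge-pred {c i′} {c j′} both-0 d))
  (reverse-prefix-suc (suc l)))
  where
  both-0 : t (c i′) ≡ t (c j′)
  both-0 = trans (cut-letter i′) (sym (cut-letter j′))

rightSpecial-at-cuts N {i} {j} lt D with diverge-preimage {i} {j} D
... | q , d , refl = begin
  factor (c i) (suc (W i q))                ≡⟨ image-factor-0 i q ⟩
  σ* (factor i q) ++ [ zero ]               ≡⟨ cong (λ w → σ* w ++ [ zero ]) reversed ⟩
  σ* (reverse (factor 0 q)) ++ [ zero ]     ≡⟨ sym (image-reverse (factor 0 q)) ⟩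
  reverse (σ* (factor 0 q) ++ [ zero ])     ≡⟨ cong reverse (sym (image-factor-0 0 q)) ⟩
  reverse (factor 0 (suc (W 0 q)))         ≡⟨ cong (λ x → reverse (factor 0 (suc x))) (sym (W-reversed-prefix reversed)) ⟩
  reverse (factor 0 (suc (W i q)))         ∎
  where
  open ≡-Reasoning
  reversed : factor i q ≡ reverse (factor 0 q)
  reversed = rightSpecial-bounded N lt d

rightSpecial : ∀ {i j l} → Diverge i j l → factor i l ≡ reverse (factor 0 l)
rightSpecial {i} {j} = rightSpecial-bounded (suc (i + j)) ≤-refl

W-rightSpecial : ∀ {i j l} → Diverge i j l → W i l ≡ W 0 l
W-rightSpecial d = W-reversed-prefix (rightSpecial d)

S : ℕ → ℕ
S zero = 0
S (suc k) = S k + T k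

Trib-rec : ∀ m → Trib (3 + m) ≡ Trib (2 + m) + Trib (1 + m) + Trib m
Trib-rec zero = refl
Trib-rec (suc m) = refl

-- S k in closed form, in the shape used by the theorem's hypotheses.
S-closed-form : ∀ m → 2 * S m + 3 ≡ Trib (2 + m) + Trib m
S-closed-form zero = refl
S-closed-form (suc m) = begin
  2 * (S m + T m) + 3                                   ≡⟨ regroup (S m) (T m) ⟩
  (2 * S m + 3) + T m + T m                             ≡⟨ cong (λ x → x + T m + T m) (S-closed-form m) ⟩
  Trib (2 + m) + Trib m + Trib (1 + m) + Trib (1 + m)   ≡⟨ regroup′ (Trib (2 + m)) (Trib (1 + m)) (Trib m) ⟩
  (Trib (2 + m) + Trib (1 + m) + Trib m) + Trib (1 + m) ≡⟨ cong (_+ Trib (1 + m)) (sym (Trib-rec m)) ⟩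
  Trib (3 + m) + Trib (1 + m)                           ∎
  where
  open ≡-Reasoning
  regroup : ∀ s x → 2 * (s + x) + 3 ≡ (2 * s + 3) + x + x
  regroup = solve-∀
  regroup′ : ∀ a b d → a + d + b + b ≡ (a + b + d) + b
  regroup′ = solve-∀

-- σ(σᵏ(0)) = σᵏ⁺¹(0), so the image of the prefix of length T k has length T (k+1).
c-T : ∀ k → c (T k) ≡ T (suc k)
c-T k = begin
  c (T k)                   ≡⟨ cong (λ w → length (σ* w)) (prefix-is-P k) ⟩
  length (P (suc k))        ≡⟨ length-P (suc k) ⟩
  T (suc k)                 ∎
  where open ≡-Reasoning

prefix-return : ∀ k → factor 0 (S k) ≡ factor (T k) (S k) × suc (c (S k)) ≡ S (suc k)
prefix-return zero = refl , refl
prefix-return (suc k) with prefix-return k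
... | returns , image-length = returns′ , image-length′
  where
  open ≡-Reasoning
  same-image : W (T k) (S k) ≡ c (S k)
  same-image = W-agree (S k) (sym returns)
  returns′ : factor 0 (S (suc k)) ≡ factor (T (suc k)) (S (suc k))
  returns′ = begin
    factor 0 (S (suc k))                      ≡⟨ cong (factor 0) (sym image-length) ⟩
    factor (c 0) (suc (c (S k)))              ≡⟨ image-agree (S k) returns ⟩
    factor (c (T k)) (suc (c (S k)))          ≡⟨ cong₂ factor (c-T k) image-length ⟩
    factor (T (suc k)) (S (suc k))            ∎
  image-length′ : suc (c (S (suc k))) ≡ S (suc (suc k))
  image-length′ = begin
    suc (c (S k + T k))                       ≡⟨ cong (λ x → suc (c x)) (+-comm (S k) (T k)) ⟩
    suc (c (T k + S k))                       ≡⟨ cong suc (W-++ 0 (T k) (S k)) ⟩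
    suc (c (T k) + W (T k) (S k))             ≡⟨ cong₂ (λ a b → suc (a + b)) (c-T k) same-image ⟩
    suc (T (suc k) + c (S k))                 ≡⟨ sym (+-suc (T (suc k)) (c (S k))) ⟩
    T (suc k) + suc (c (S k))                 ≡⟨ cong (T (suc k) +_) image-length ⟩
    T (suc k) + S (suc k)                     ≡⟨ +-comm (T (suc k)) (S (suc k)) ⟩
    S (suc (suc k))                           ∎

diverge-image-bounded : ∀ k {i j l} → l ≤ S k → Diverge i j l → suc (W i l) ≤ S (suc k)
diverge-image-bounded k {i} {l = l} l≤S d = subst (suc (W i l) ≤_) (proj₂ (prefix-return k))
  (s≤s (subst (_≤ c (S k)) (sym (W-rightSpecial d)) (W-mono 0 l≤S)))

block-index-below : ∀ k {m} → c m < T (suc k) → m < T k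
block-index-below k cm< = c-reflects-< (subst (_ <_) (sym (c-T k)) cm<)

-- Equal
-- letters are aligned in blocks whose indices lie below T k, and the divergence
-- given by the induction hypothesis for those indices lifts.
separation : ∀ k {i j} → i < j → j < T (suc k) → ∃[ l ] l ≤ S k × Diverge i j l
separation zero {zero} {suc zero} _ _ = 0 , z≤n , diverge refl (λ ())
separation zero {suc _} {suc zero} (s≤s ()) _
separation zero {_} {suc (suc _)} _ (s≤s (s≤s ()))
separation (suc k) {i} {j} i<j j<T with t i ≟ᶠ t j
... | no ti≢tj = 0 , z≤n , diverge-at-0 ti≢tj
... | yes ti≡tj with align {i} {j} ti≡tj
...   | at-cuts i′ j′ with separation k {i′} {j′} (c-reflects-< i<j) (block-index-below (suc k) j<T)
...     | l , l≤S , d = suc (W i′ l) , diverge-image-bounded k l≤S d , diverge-image d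
separation (suc k) {i} {j} i<j j<T | yes ti≡tj | after-cuts i′ j′
  with separation k {i′} {j′} (c-reflects-< (≤-pred i<j))
                              (block-index-below (suc k) (<-trans (n<1+n _) j<T))
...     | l , l≤S , d =
  W i′ l , ≤-trans (n≤1+n _) (diverge-image-bounded k l≤S d) , diverge-suc (diverge-image d)

-- x ↦ 2x + 3 reflects the order; with S-closed-form the hypotheses of the theorem
-- then say S (k-1) < n ≤ S k.
affine-cancel-< : ∀ {a b} → 2 * a + 3 < 2 * b + 3 → a < b
affine-cancel-< lt = *-cancelˡ-< 2 _ _ (+-cancelʳ-< 3 _ _ lt)

affine-cancel-≤ : ∀ {a b} → 2 * b + 3 ≤ 2 * a + 3 → b ≤ a
affine-cancel-≤ le = *-cancelˡ-≤ 2 (+-cancelʳ-≤ 3 _ _ le)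

mainTheorem4 : (k n : ℕ) → 1 ≤ k →
    Trib (suc k) + Trib (k ∸ 1) < 2 * n + 3 →
    2 * n + 3 ≤ Trib (suc (suc k)) + Trib k →
    IsNsc t n (T k)
mainTheorem4 zero n () _ _
mainTheorem4 (suc k) n _ lower upper = distinct , maximal
  where
  S<n : S k < n
  S<n = affine-cancel-< (subst (_< 2 * n + 3) (sym (S-closed-form k)) lower)
  n≤S : n ≤ S (suc k)
  n≤S = affine-cancel-≤ (subst (2 * n + 3 ≤_) (sym (S-closed-form (suc k))) upper)
  distinct : FirstDistinct t n (T (suc k))
  distinct i j i<j j<T same with separation k i<j j<T
  ... | l , l≤S , d = differ d (same l (≤-<-trans l≤S S<n))
  recurrence : SameFactor t n 0 (T (suc k))
  recurrence l l<n = factors-agree (proj₁ (prefix-return (suc k))) l (<-≤-trans l<n n≤S)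
  maximal : ∀ m → FirstDistinct t n m → m ≤ T (suc k)
  maximal m distinct-m =
    ≮⇒≥ (λ T<m → distinct-m 0 (T (suc k)) (≤-<-trans z≤n (T-grows (suc k))) T<m recurrence)
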